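{- For every integer $k \geq 2$, $RR(\mathcal{E}(2k,0)) = 2k$ and $RR(\mathcal{E}(2k-1,0)) = 3k-1$. Furthermore, $RR(\mathcal{E}(2,0)) = 5$ and $RR(\mathcal{E}(1,0)) = 11$.
   Context: For a positive integer $k$ and an integer $j > -k$, $\mathcal{E}(k,j)$ denotes the equation $x+y+kz=(k+j)w$. A $2$-coloring of $[1,N]=\{1,2,\dots,N\}$ is a map $\chi:[1,N]\to\{0,1\}$; a solution $(x,y,z,w)$ with $x,y,z,w\in[1,N]$ (not necessarily distinct) is monochromatic if $\chi(x)=\chi(y)=\chi(z)=\chi(w)$. For an equation $\mathcal{E}$, $RR(\mathcal{E})$ denotes the minimum positive integer $N$ such that every $2$-coloring of $[1,N]$ admits a monochromatic solution to $\mathcal{E}$ in $[1,N]$. -}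

module Defs where

open import Data.Nat as ℕ using (ℕ; suc; _≤_)
open import Data.Integer as ℤ using (ℤ; +_)
open import Data.Bool using (Bool)
open import Data.Product using (_×_; ∃-syntax)
open import Relation.Binary.PropositionalEquality using (_≡_)

InRange : ℕ → ℕ → Set
InRange N x = 1 ≤ x × x ≤ N

-- The equation E(k,j) : x + y + k z = (k + j) w, over the integers.
-- (k : ℕ positive, j : ℤ with j > -k; these side conditions are imposed
--  where the equation is used.)
Eq𝓔 : ℕ → ℤ → ℕ → ℕ → ℕ → ℕ → Set
Eq𝓔 k j x y z w =
  (+ x) ℤ.+ (+ y) ℤ.+ (+ k) ℤ.* (+ z) ≡ ((+ k) ℤ.+ j) ℤ.* (+ w)

-- A 2-coloring of [1,N] (values outside [1,N] are irrelevant).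
Coloring : Set
Coloring = ℕ → Bool

HasMonoSol : ℕ → ℤ → ℕ → Coloring → Set
HasMonoSol k j N χ =
  ∃[ x ] ∃[ y ] ∃[ z ] ∃[ w ]
    (InRange N x × InRange N y × InRange N z × InRange N w ×
     χ x ≡ χ y × χ y ≡ χ z × χ z ≡ χ w ×
     Eq𝓔 k j x y z w)

Forces : ℕ → ℤ → ℕ → Set
Forces k j N = (χ : Coloring) → HasMonoSol k j N χ

RR≡ : ℕ → ℤ → ℕ → Set
RR≡ k j N = 1 ≤ N × Forces k j N × ((M : ℕ) → 1 ≤ M → Forces k j M → N ≤ M)

-- A solution of x + y + K z = K w with x, y, z, w ∈ [1, N] has w = z + d with d ≥ 1 and
-- x + y = d K ≤ 2N, so only small steps d matter.
--
-- Lower bounds: on [1, 2k - 1] the parity colouring kills the step d = 1 of E(2k, 0), and d ≥ 2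
-- is too large; on [1, 3k - 2] the 4-periodic pattern 0011 (shifted by k - 2) kills d = 1, since
-- x + y = 2k - 1 makes the shifted sum 3 mod 4, and d = 2, since it flips colour at distance 2,
-- while d ≥ 3 is too large.
--
-- Upper bounds: a monochromatic solution exists as soon as its absence is contradictory, the
-- search being finite. For K = 2k, two of K - 2, K - 1, K share a colour; K - 2 and K are a step-2
-- solution, and an equal consecutive pair z, z + 1 combines with k + k = (k - 1) + (k + 1) = K,
-- since the pairs (k - 1, k) and (k, k + 1) must be bichromatic. For K = 2k - 1 and N = 3k - 1,
-- the pairs K + K = (K - 2) + (K + 2) = 2K forbid equal colours at distance 2; then
-- (k - 1) + k = K makes k, k + 1 an equal pair, which propagates by steps of 2 up to N - 1, N,
-- and N - 4 coloured like N completes the step-3 solution (N - 1, N, N - 4, N - 1).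
-- For E(2, 0) and E(1, 0) the upper bounds are short case analyses starting from χ 1 and χ 2,
-- and the lower-bound colourings are certified by evaluating the decision procedure.

module Submission where

open import Defs
open import Data.Nat using (ℕ; zero; suc; _+_; _*_; _≤_; _<_; s≤s; z≤n; _≤?_; _<?_; _≟_; _≤ᵇ_; _∸_; pred)
open import Data.Nat.Properties
  using (anyUpTo?; ≤-refl; ≤-trans; <-irrefl; ≤-<-trans; ≤-reflexive; <-≤-trans; <⇒≱; ≰⇒>; ≮⇒≥; m≤n⇒∃[o]m+o≡n;
         m≤m+n; m≤n+m; n≤1+n; m<n+m; +-mono-≤; *-monoˡ-≤; *-monoʳ-≤;
         +-comm; +-suc; +-identityʳ; +-cancelʳ-≡; suc-injective)
open import Data.Nat.Tactic.RingSolver using (solve; solve-∀)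
open import Data.Integer as ℤ using (ℤ; +_)
import Data.Integer.Properties as ℤ
open import Data.Bool using (Bool; true; false; not; _∧_)
open import Data.Bool.Properties as Bool using (¬-not; not-¬; not-involutive)
open import Data.List using ([]; _∷_)
open import Data.Product using (_×_; _,_; ∃-syntax)
open import Data.Empty using (⊥; ⊥-elim)
open import Relation.Nullary using (¬_; yes; no)
open import Relation.Nullary.Decidable
  using (Dec; map′; _×-dec_; True; toWitness; from-no; decidable-stable)
open import Relation.Unary using (Decidable)
open import Relation.Binary.PropositionalEquality
  using (_≡_; _≢_; refl; sym; trans; cong; subst; subst₂; ≢-sym; module ≡-Reasoning)

Eq𝓔₀-lhs : ∀ K x y z → + x ℤ.+ + y ℤ.+ + K ℤ.* + z ≡ + (x + y + K * z)
Eq𝓔₀-lhs K x y z = cong (ℤ._+_ (+ (x + y))) (sym (ℤ.pos-* K z))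

Eq𝓔₀-rhs : ∀ K w → (+ K ℤ.+ + 0) ℤ.* + w ≡ + (K * w)
Eq𝓔₀-rhs K w = trans (sym (ℤ.pos-* (K + 0) w)) (cong (λ k → + (k * w)) (+-identityʳ K))

ℕ⇒Eq𝓔₀ : ∀ K x y z w → x + y + K * z ≡ K * w → Eq𝓔 K (+ 0) x y z w
ℕ⇒Eq𝓔₀ K x y z w eq = trans (Eq𝓔₀-lhs K x y z) (trans (cong +_ eq) (sym (Eq𝓔₀-rhs K w)))

Eq𝓔₀⇒ℕ : ∀ K x y z w → Eq𝓔 K (+ 0) x y z w → x + y + K * z ≡ K * w
Eq𝓔₀⇒ℕ K x y z w eq = ℤ.+-injective (trans (sym (Eq𝓔₀-lhs K x y z)) (trans eq (Eq𝓔₀-rhs K w)))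

InRange? : ∀ N → Decidable (InRange N)
InRange? N x = 1 ≤? x ×-dec x ≤? N

∃-InRange? : ∀ N {P : ℕ → Set} → Decidable P → Dec (∃[ x ] (InRange N x × P x))
∃-InRange? N {P} P? = map′ to from (anyUpTo? (λ x → InRange? N x ×-dec P? x) (suc N))
  where
  to : ∃[ x ] (x < suc N × InRange N x × P x) → ∃[ x ] (InRange N x × P x)
  to (x , _ , x∈ , Px) = x , x∈ , Px
  from : ∃[ x ] (InRange N x × P x) → ∃[ x ] (x < suc N × InRange N x × P x)
  from (x , (1≤x , x≤N) , Px) = x , s≤s x≤N , (1≤x , x≤N) , Px

MonoSolution : ℕ → ℤ → Coloring → ℕ → ℕ → ℕ → ℕ → Set
MonoSolution K j χ x y z w = χ x ≡ χ y × χ y ≡ χ z × χ z ≡ χ w × Eq𝓔 K j x y z w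

HasMonoSol? : ∀ K j N χ → Dec (HasMonoSol K j N χ)
HasMonoSol? K j N χ = map′ to from
  (∃-InRange? N λ x → ∃-InRange? N λ y → ∃-InRange? N λ z → ∃-InRange? N λ w →
     χ x Bool.≟ χ y ×-dec χ y Bool.≟ χ z ×-dec χ z Bool.≟ χ w ×-dec
     (+ x ℤ.+ + y ℤ.+ + K ℤ.* + z) ℤ.≟ (+ K ℤ.+ j) ℤ.* + w)
  where
  Nested : Set
  Nested = ∃[ x ] (InRange N x × ∃[ y ] (InRange N y × ∃[ z ] (InRange N z ×
             ∃[ w ] (InRange N w × MonoSolution K j χ x y z w))))
  to : Nested → HasMonoSol K j N χ
  to (x , x∈ , y , y∈ , z , z∈ , w , w∈ , mono) = x , y , z , w , x∈ , y∈ , z∈ , w∈ , mono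
  from : HasMonoSol K j N χ → Nested
  from (x , y , z , w , x∈ , y∈ , z∈ , w∈ , mono) = x , x∈ , y , y∈ , z , z∈ , w , w∈ , mono

HasMonoSol-mono : ∀ {K j M N χ} → M ≤ N → HasMonoSol K j M χ → HasMonoSol K j N χ
HasMonoSol-mono {M = M} {N} M≤N (x , y , z , w , x∈ , y∈ , z∈ , w∈ , mono) =
  x , y , z , w , widen x∈ , widen y∈ , widen z∈ , widen w∈ , mono
  where
  widen : ∀ {v} → InRange M v → InRange N v
  widen (1≤v , v≤M) = 1≤v , ≤-trans v≤M M≤N

RR≡-intro : ∀ K j N (χ₀ : Coloring) → ¬ HasMonoSol K j N χ₀ →
            ((χ : Coloring) → ¬ ¬ HasMonoSol K j (suc N) χ) → RR≡ K j (suc N)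
RR≡-intro K j N χ₀ free refute =
  s≤s z≤n , forces , λ M _ forcesM → ≰⇒> λ M≤N → free (HasMonoSol-mono {K} {j} M≤N (forcesM χ₀))
  where
  forces : Forces K j (suc N)
  forces χ = decidable-stable (HasMonoSol? K j (suc N) χ) (refute χ)

two-colours : ∀ {a b c : Bool} → a ≢ c → b ≢ c → a ≡ b
two-colours a≢c b≢c = trans (¬-not a≢c) (sym (¬-not b≢c))

complements-≡ : ∀ {a b c d : Bool} → a ≢ c → b ≢ d → a ≡ b → c ≡ d
complements-≡ a≢c b≢d refl = trans (¬-not (≢-sym a≢c)) (sym (¬-not (≢-sym b≢d)))

solution-shift : ∀ K x y z w → 1 ≤ x → x + y + K * z ≡ K * w →
                 ∃[ d ] (w ≡ suc d + z × x + y ≡ suc d * K)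
solution-shift K x y z w 1≤x eq with z <? w
... | no z≮w = ⊥-elim (<-irrefl (sym eq) (≤-<-trans (*-monoʳ-≤ K w≤z) Kz<lhs))
  where
  w≤z : w ≤ z
  w≤z = ≮⇒≥ z≮w
  Kz<lhs : K * z < x + y + K * z
  Kz<lhs = m<n+m (K * z) (≤-trans 1≤x (m≤m+n x y))
... | yes z<w with m≤n⇒∃[o]m+o≡n z<w
... | d , refl = d , cong suc (+-comm z d) , +-cancelʳ-≡ (K * z) (x + y) (suc d * K) (trans eq (shift K z d))
  where
  shift : ∀ K z d → K * (suc z + d) ≡ suc d * K + K * z
  shift = solve-∀

sum≢large-multiple : ∀ {N K x y} s e → x ≤ N → y ≤ N → N + N < s * K → x + y ≢ (s + e) * K
sum≢large-multiple {N} {K} s e x≤N y≤N 2N<sK eq =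
  <⇒≱ (<-≤-trans 2N<sK (*-monoˡ-≤ K (m≤m+n s e))) (subst (_≤ N + N) eq (+-mono-≤ x≤N y≤N))

≤-by-offset : ∀ {m n} k → m + k ≡ n → m ≤ n
≤-by-offset {m} k eq = subst (m ≤_) eq (m≤m+n m k)

module NoMonoSolution (K N : ℕ) (χ : Coloring) (free : ¬ HasMonoSol K (+ 0) N χ) where

  in-range : ∀ a c → suc a + c ≡ N → InRange N (suc a)
  in-range a c eq = s≤s z≤n , ≤-by-offset c eq

  mono-free : ∀ x y z w → InRange N x → InRange N y → InRange N z → InRange N w →
              x + y + K * z ≡ K * w → ¬ (χ x ≡ χ y × χ y ≡ χ z × χ z ≡ χ w)
  mono-free x y z w x∈ y∈ z∈ w∈ eq (xy , yz , zw) =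
    free (x , y , z , w , x∈ , y∈ , z∈ , w∈ , xy , yz , zw , ℕ⇒Eq𝓔₀ K x y z w eq)

  forced : ∀ x y z w {x∈ : True (InRange? N x)} {y∈ : True (InRange? N y)}
           {z∈ : True (InRange? N z)} {w∈ : True (InRange? N w)}
           {eq : True (x + y + K * z ≟ K * w)} {c} →
           χ x ≡ c → χ y ≡ c → χ z ≡ c → χ w ≡ not c
  forced x y z w {x∈} {y∈} {z∈} {w∈} {eq} xc yc zc = ¬-not λ wc →
    mono-free x y z w (toWitness x∈) (toWitness y∈) (toWitness z∈) (toWitness w∈) (toWitness eq)
      (trans xc (sym yc) , trans yc (sym zc) , trans zc (sym wc))

parity : Coloring
parity zero = true
parity (suc n) = not (parity n)

parity-free : ∀ m → ¬ HasMonoSol (4 + 2 * m) (+ 0) (3 + 2 * m) parity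
parity-free m (x , y , z , w , (1≤x , x≤N) , (_ , y≤N) , _ , _ , _ , _ , zw , eq)
  with solution-shift (4 + 2 * m) x y z w 1≤x (Eq𝓔₀⇒ℕ (4 + 2 * m) x y z w eq)
... | zero , refl , _ = not-¬ refl zw
... | suc e , _ , sum = sum≢large-multiple {3 + 2 * m} {4 + 2 * m} 2 e x≤N y≤N (≤-by-offset 1 (solve (m ∷ []))) sum

-- Points are named relative to k = 2 + m and K = 2k, which is also the length of the interval.
module EvenForcing (m : ℕ) (χ : Coloring) (free : ¬ HasMonoSol (4 + 2 * m) (+ 0) (4 + 2 * m) χ) where
  open NoMonoSolution (4 + 2 * m) (4 + 2 * m) χ free

  k-1∈ : InRange (4 + 2 * m) (1 + m)
  k-1∈ = in-range m (3 + m) (solve (m ∷ []))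
  k∈ : InRange (4 + 2 * m) (2 + m)
  k∈ = in-range (1 + m) (2 + m) (solve (m ∷ []))
  k+1∈ : InRange (4 + 2 * m) (3 + m)
  k+1∈ = in-range (2 + m) (1 + m) (solve (m ∷ []))
  K-2∈ : InRange (4 + 2 * m) (2 + 2 * m)
  K-2∈ = in-range (1 + 2 * m) 2 (solve (m ∷ []))
  K-1∈ : InRange (4 + 2 * m) (3 + 2 * m)
  K-1∈ = in-range (2 + 2 * m) 1 (solve (m ∷ []))
  K∈ : InRange (4 + 2 * m) (4 + 2 * m)
  K∈ = in-range (3 + 2 * m) 0 (solve (m ∷ []))

  k-1≢k : χ (1 + m) ≢ χ (2 + m)
  k-1≢k e = mono-free (2 + m) (2 + m) (1 + m) (2 + m) k∈ k∈ k-1∈ k∈ (solve (m ∷ [])) (refl , sym e , e)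

  k+1≢k : χ (3 + m) ≢ χ (2 + m)
  k+1≢k e = mono-free (2 + m) (2 + m) (2 + m) (3 + m) k∈ k∈ k∈ k+1∈ (solve (m ∷ [])) (refl , refl , sym e)

  consecutive-distinct : ∀ z → InRange (4 + 2 * m) z → InRange (4 + 2 * m) (1 + z) → χ z ≢ χ (1 + z)
  consecutive-distinct z z∈ 1+z∈ same with χ (2 + m) Bool.≟ χ z
  ... | yes k≡z = mono-free (2 + m) (2 + m) z (1 + z) k∈ k∈ z∈ 1+z∈ (solve (m ∷ z ∷ [])) (refl , k≡z , same)
  ... | no k≢z =
    mono-free (1 + m) (3 + m) z (1 + z) k-1∈ k+1∈ z∈ 1+z∈ (solve (m ∷ z ∷ []))
      (trans k-1≡z (sym k+1≡z) , k+1≡z , same)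
    where
    k-1≡z : χ (1 + m) ≡ χ z
    k-1≡z = two-colours k-1≢k (≢-sym k≢z)
    k+1≡z : χ (3 + m) ≡ χ z
    k+1≡z = two-colours k+1≢k (≢-sym k≢z)

  absurd : ⊥
  absurd with χ (2 + 2 * m) Bool.≟ χ (3 + 2 * m) | χ (3 + 2 * m) Bool.≟ χ (4 + 2 * m)
  ... | yes e | _ = consecutive-distinct (2 + 2 * m) K-2∈ K-1∈ e
  ... | no _ | yes e = consecutive-distinct (3 + 2 * m) K-1∈ K∈ e
  ... | no p | no q =
    mono-free (4 + 2 * m) (4 + 2 * m) (2 + 2 * m) (4 + 2 * m) K∈ K∈ K-2∈ K∈ (solve (m ∷ []))
      (refl , sym K-2≡K , K-2≡K)
    where
    K-2≡K : χ (2 + 2 * m) ≡ χ (4 + 2 * m)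
    K-2≡K = two-colours p (≢-sym q)

RR-even : ∀ m → RR≡ (4 + 2 * m) (+ 0) (4 + 2 * m)
RR-even m = RR≡-intro (4 + 2 * m) (+ 0) (3 + 2 * m) parity (parity-free m) (EvenForcing.absurd m)

pairs : Coloring
pairs zero = false
pairs (suc zero) = false
pairs (suc (suc n)) = not (pairs n)

pairs-periodic : ∀ n i → pairs (n * 4 + i) ≡ pairs i
pairs-periodic zero i = refl
pairs-periodic (suc n) i = trans (not-involutive _) (pairs-periodic n i)

pairs-opposite : ∀ n a b → a + b ≡ n * 4 + 3 → pairs a ≡ not (pairs b)
pairs-opposite n zero b eq = sym (cong not (trans (cong pairs eq) (pairs-periodic n 3)))
pairs-opposite n (suc zero) b eq =
  sym (cong not (trans (cong pairs (suc-injective (trans eq (+-suc (n * 4) 2)))) (pairs-periodic n 2)))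
pairs-opposite n (suc (suc a)) b eq =
  trans (cong not (pairs-opposite n a (2 + b) eq′)) (not-involutive (not (pairs b)))
  where
  eq′ : a + suc (suc b) ≡ n * 4 + 3
  eq′ = trans (+-suc a (suc b)) (trans (cong suc (+-suc a b)) eq)

shifted-pairs : ℕ → Coloring
shifted-pairs m i = pairs (i + m)

shifted-pairs-free : ∀ m → ¬ HasMonoSol (3 + 2 * m) (+ 0) (4 + 3 * m) (shifted-pairs m)
shifted-pairs-free m (x , y , z , w , (1≤x , x≤N) , (_ , y≤N) , _ , _ , xy , _ , zw , eq)
  with solution-shift (3 + 2 * m) x y z w 1≤x (Eq𝓔₀⇒ℕ (3 + 2 * m) x y z w eq)
... | zero , _ , sum = not-¬ xy (pairs-opposite m (x + m) (y + m) shifted-sum)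
  where
  open ≡-Reasoning
  shifted-sum : (x + m) + (y + m) ≡ m * 4 + 3
  shifted-sum = begin
    (x + m) + (y + m)      ≡⟨ solve (x ∷ y ∷ m ∷ []) ⟩
    (x + y) + 2 * m        ≡⟨ cong (_+ 2 * m) sum ⟩
    1 * (3 + 2 * m) + 2 * m ≡⟨ solve (m ∷ []) ⟩
    m * 4 + 3              ∎
... | suc zero , refl , _ = not-¬ refl zw
... | suc (suc e) , _ , sum =
  sum≢large-multiple {4 + 3 * m} {3 + 2 * m} 3 e x≤N y≤N (≤-by-offset 0 (solve (m ∷ []))) sum

-- Points are named relative to k = 2 + m, K = 2k - 1 and N = 3k - 1, the length of the interval.
module OddForcing (m : ℕ) (χ : Coloring) (free : ¬ HasMonoSol (3 + 2 * m) (+ 0) (5 + 3 * m) χ) where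
  open NoMonoSolution (3 + 2 * m) (5 + 3 * m) χ free

  k-1∈ : InRange (5 + 3 * m) (1 + m)
  k-1∈ = in-range m (4 + 2 * m) (solve (m ∷ []))
  k∈ : InRange (5 + 3 * m) (2 + m)
  k∈ = in-range (1 + m) (3 + 2 * m) (solve (m ∷ []))
  K-2∈ : InRange (5 + 3 * m) (1 + 2 * m)
  K-2∈ = in-range (2 * m) (4 + m) (solve (m ∷ []))
  K∈ : InRange (5 + 3 * m) (3 + 2 * m)
  K∈ = in-range (2 + 2 * m) (2 + m) (solve (m ∷ []))
  K+2∈ : InRange (5 + 3 * m) (5 + 2 * m)
  K+2∈ = in-range (4 + 2 * m) m (solve (m ∷ []))
  N-4∈ : InRange (5 + 3 * m) (1 + 3 * m)
  N-4∈ = in-range (3 * m) 4 (solve (m ∷ []))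
  N-1∈ : InRange (5 + 3 * m) (4 + 3 * m)
  N-1∈ = in-range (3 + 3 * m) 1 (solve (m ∷ []))
  N∈ : InRange (5 + 3 * m) (5 + 3 * m)
  N∈ = in-range (4 + 3 * m) 0 (solve (m ∷ []))

  K-2≢K : χ (1 + 2 * m) ≢ χ (3 + 2 * m)
  K-2≢K e = mono-free (3 + 2 * m) (3 + 2 * m) (1 + 2 * m) (3 + 2 * m) K∈ K∈ K-2∈ K∈ (solve (m ∷ []))
    (refl , sym e , e)

  K+2≢K : χ (5 + 2 * m) ≢ χ (3 + 2 * m)
  K+2≢K e = mono-free (3 + 2 * m) (3 + 2 * m) (3 + 2 * m) (5 + 2 * m) K∈ K∈ K∈ K+2∈ (solve (m ∷ []))
    (refl , refl , sym e)

  gap-two-distinct : ∀ z → 1 ≤ z → 2 + z ≤ 5 + 3 * m → χ z ≢ χ (2 + z)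
  gap-two-distinct z 1≤z 2+z≤N = distinct (1≤z , ≤-trans (m≤n+m z 2) 2+z≤N) (s≤s z≤n , 2+z≤N)
    where
    distinct : InRange (5 + 3 * m) z → InRange (5 + 3 * m) (2 + z) → χ z ≢ χ (2 + z)
    distinct z∈ 2+z∈ same with χ z Bool.≟ χ (3 + 2 * m)
    ... | yes z≡K =
      mono-free (3 + 2 * m) (3 + 2 * m) z (2 + z) K∈ K∈ z∈ 2+z∈ (solve (m ∷ z ∷ [])) (refl , sym z≡K , same)
    ... | no z≢K =
      mono-free (1 + 2 * m) (5 + 2 * m) z (2 + z) K-2∈ K+2∈ z∈ 2+z∈ (solve (m ∷ z ∷ []))
        (two-colours K-2≢K K+2≢K , two-colours K+2≢K z≢K , same)

  equal-pairs-propagate : ∀ n q → 1 ≤ q → 1 + (n * 2 + q) ≤ 5 + 3 * m →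
                          χ q ≡ χ (1 + q) → χ (n * 2 + q) ≡ χ (1 + (n * 2 + q))
  equal-pairs-propagate zero q _ _ same = same
  equal-pairs-propagate (suc n) q 1≤q bound same =
    complements-≡ (gap-two-distinct p (≤-trans 1≤q (m≤n+m q (n * 2))) (≤-trans (n≤1+n (2 + p)) bound))
                  (gap-two-distinct (1 + p) (s≤s z≤n) bound)
                  (equal-pairs-propagate n q 1≤q (≤-trans (m≤n+m (1 + p) 2) bound) same)
    where
    p : ℕ
    p = n * 2 + q

  absurd : ⊥
  absurd = mono-free (4 + 3 * m) (5 + 3 * m) (1 + 3 * m) (4 + 3 * m) N-1∈ N∈ N-4∈ N-1∈ (solve (m ∷ []))
    (top-pair , sym ends , trans ends (sym top-pair))
    where
    k-1≢k : χ (1 + m) ≢ χ (2 + m)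
    k-1≢k e = mono-free (1 + m) (2 + m) (1 + m) (2 + m) k-1∈ k∈ k-1∈ k∈ (solve (m ∷ [])) (e , sym e , e)
    middle-pair : χ (2 + m) ≡ χ (3 + m)
    middle-pair = two-colours (≢-sym k-1≢k)
      (≢-sym (gap-two-distinct (1 + m) (s≤s z≤n) (≤-by-offset (2 + 2 * m) (solve (m ∷ [])))))
    top : suc m * 2 + (2 + m) ≡ 4 + 3 * m
    top = solve (m ∷ [])
    top-pair : χ (4 + 3 * m) ≡ χ (5 + 3 * m)
    top-pair = subst (λ p → χ p ≡ χ (1 + p)) top
      (equal-pairs-propagate (suc m) (2 + m) (s≤s z≤n) (≤-reflexive (cong suc top)) middle-pair)
    ends : χ (1 + 3 * m) ≡ χ (5 + 3 * m)
    ends = two-colours (gap-two-distinct (1 + 3 * m) (s≤s z≤n) (m≤n+m (3 + 3 * m) 2))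
                       (≢-sym (gap-two-distinct (3 + 3 * m) (s≤s z≤n) ≤-refl))

RR-odd : ∀ m → RR≡ (3 + 2 * m) (+ 0) (5 + 3 * m)
RR-odd m = RR≡-intro (3 + 2 * m) (+ 0) (4 + 3 * m) (shifted-pairs m) (shifted-pairs-free m) (OddForcing.absurd m)

E₂-colouring : Coloring
E₂-colouring 2 = true
E₂-colouring 3 = true
E₂-colouring _ = false

-- Writing a = χ 1, a fact named na states χ n ≡ a and nb states χ n ≡ not a (up to double negation).
E₂-forcing : (χ : Coloring) → ¬ HasMonoSol 2 (+ 0) 5 χ → ⊥
E₂-forcing χ free = not-¬ 5b 5a
  where
  open NoMonoSolution 2 5 χ free
  2b : χ 2 ≡ not (χ 1)
  2b = forced 1 1 1 2 refl refl refl
  3b : χ 3 ≡ not (χ 1)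
  3b = ¬-not λ 3a → not-¬ 3a (forced 1 3 1 3 refl 3a refl)
  4a : χ 4 ≡ χ 1
  4a = trans (forced 2 2 2 4 2b 2b 2b) (not-involutive (χ 1))
  5b : χ 5 ≡ not (χ 1)
  5b = forced 1 1 4 5 refl refl 4a
  5a : χ 5 ≡ not (not (χ 1))
  5a = forced 2 2 3 5 2b 2b 3b

RR-E₂ : RR≡ 2 (+ 0) 5
RR-E₂ = RR≡-intro 2 (+ 0) 4 E₂-colouring (from-no (HasMonoSol? 2 (+ 0) 4 E₂-colouring)) E₂-forcing

E₁-colouring : Coloring
E₁-colouring n = (3 ≤ᵇ n) ∧ (n ≤ᵇ 8)

E₁-forcing : (χ : Coloring) → ¬ HasMonoSol 1 (+ 0) 11 χ → ⊥
E₁-forcing χ free with χ 2 Bool.≟ χ 1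
... | yes 2a = not-¬ 11b 11a
  where
  open NoMonoSolution 1 11 χ free
  3b : χ 3 ≡ not (χ 1)
  3b = forced 1 1 1 3 refl refl refl
  5b : χ 5 ≡ not (χ 1)
  5b = forced 1 2 2 5 refl 2a 2a
  9a : χ 9 ≡ χ 1
  9a = trans (forced 3 3 3 9 3b 3b 3b) (not-involutive (χ 1))
  11a : χ 11 ≡ not (not (χ 1))
  11a = forced 3 3 5 11 3b 3b 5b
  11b : χ 11 ≡ not (χ 1)
  11b = forced 1 1 9 11 refl refl 9a
... | no 2≢1 = not-¬ 8b 8a
  where
  open NoMonoSolution 1 11 χ free
  2b : χ 2 ≡ not (χ 1)
  2b = ¬-not 2≢1
  6a : χ 6 ≡ χ 1
  6a = trans (forced 2 2 2 6 2b 2b 2b) (not-involutive (χ 1))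
  4b : χ 4 ≡ not (χ 1)
  4b = ¬-not λ 4a → not-¬ 6a (forced 1 1 4 6 refl refl 4a)
  8a : χ 8 ≡ not (not (χ 1))
  8a = forced 2 2 4 8 2b 2b 4b
  8b : χ 8 ≡ not (χ 1)
  8b = forced 1 1 6 8 refl refl 6a

RR-E₁ : RR≡ 1 (+ 0) 11
RR-E₁ = RR≡-intro 1 (+ 0) 10 E₁-colouring (from-no (HasMonoSol? 1 (+ 0) 10 E₁-colouring)) E₁-forcing

theorem3 : ((k : ℕ) → 2 ≤ k →
             RR≡ (2 * k) (+ 0) (2 * k) × RR≡ (2 * k ∸ 1) (+ 0) (3 * k ∸ 1))
           × RR≡ 2 (+ 0) 5 × RR≡ 1 (+ 0) 11
theorem3 = families , RR-E₂ , RR-E₁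
  where
  families : (k : ℕ) → 2 ≤ k → RR≡ (2 * k) (+ 0) (2 * k) × RR≡ (2 * k ∸ 1) (+ 0) (3 * k ∸ 1)
  families (suc zero) (s≤s ())
  families (suc (suc m)) _ =
    subst (λ K → RR≡ K (+ 0) K) 2k≡ (RR-even m) ,
    subst₂ (λ K N → RR≡ K (+ 0) N) (cong pred 2k≡) (cong pred 3k≡) (RR-odd m)
    where
    2k≡ : 4 + 2 * m ≡ 2 * (2 + m)
    2k≡ = solve (m ∷ [])
    3k≡ : 6 + 3 * m ≡ 3 * (2 + m)
    3k≡ = solve (m ∷ [])
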